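{- Let $\mathbf{s}=(s_1,\dots,s_n)$ be a sequence of positive integers with $s_n=1$. Then for each $i$, \[\mathcal{L}^i(\operatorname{Par}_{\mathbf{s}})=\{\mathbf{x}\in\operatorname{Par}_{\mathbf{s}}\cap\mathbb{Z}^n:\operatorname{des}_{\mathbf{s}}(\operatorname{REM}_{\mathbf{s}}(\mathbf{x}))=i\}=\{\operatorname{REM}_{\mathbf{s}}^{ -1}(\mathbf{r}):\mathbf{r}\in\Psi_n,\ \operatorname{des}_{\mathbf{s}}(\mathbf{r})=i\},\] and $\ell^i(\operatorname{Par}_{\mathbf{s}})=\#\{\mathbf{r}\in\Psi_n:\operatorname{des}_{\mathbf{s}}(\mathbf{r})=i\}$.
   Context: $\langle N\rangle=\{0,\dots,N\}$, $\Psi_n=\langle s_1-1\rangle\times\cdots\times\langle s_n-1\rangle$. $\operatorname{Par}_{\mathbf{s}}=\{\sum_{j=1}^n c_j\mathbf{w}_j:0\le c_j<1\}$ with $\mathbf{w}_j=(0,\dots,0,s_j,\dots,s_n)$ ($j-1$ leading zeros). $\mathcal{L}^i(S)$ is the set of points of $S\cap\mathbb{Z}^n$ with last coordinate $i$ and $\ell^i(S)=\#\mathcal{L}^i(S)$. $\operatorname{REM}_{\mathbf{s}}:\operatorname{Par}_{\mathbf{s}}\cap\mathbb{Z}^n\to\Psi_n$ maps $\mathbf{x}$ to the vector of remainders of $x_i$ modulo $s_i$ (in $\langle s_i-1\rangle$); it is a bijection. $\operatorname{des}_{\mathbf{s}}(\mathbf{r})=\#\{i\in\{1,\dots,n-1\}:r_i/s_i>r_{i+1}/s_{i+1}\}$.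 -}

module Defs where

open import Data.Nat as ℕ using (ℕ; zero; suc; _<_; NonZero; >-nonZero)
open import Data.Integer as ℤ using (ℤ; +_)
open import Data.Integer.DivMod using (_%ℕ_)
open import Data.Rational as ℚ using (ℚ; 0ℚ; 1ℚ; _/_)
open import Data.Rational.Properties using (_<?_)
open import Data.Fin using (Fin; zero; suc; toℕ)
open import Data.Vec using (Vec; []; _∷_; lookup; tabulate; toList)
open import Data.List as List using (List; []; _∷_; length)
open import Data.List.Membership.Propositional using (_∈_)
open import Data.List.Relation.Unary.Unique.Propositional using (Unique)
open import Data.Bool using (if_then_else_)
open import Data.Product using (Σ; _×_)
open import Function.Bundles using (_⇔_)
open import Relation.Binary.PropositionalEquality using (_≡_)
open import Relation.Nullary.Decidable using (does)

Positive : ∀ {n} → Vec ℕ n → Set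
Positive s = ∀ k → 0 < lookup s k

sumᶠ : ∀ {n} → (Fin n → ℚ) → ℚ
sumᶠ {zero}  f = 0ℚ
sumᶠ {suc n} f = f zero ℚ.+ sumᶠ (λ j → f (suc j))

-- w_j = (0,...,0,s_j,...,s_n)  (j-1 leading zeros); coordinate k of w_j.
w : ∀ {n} → Vec ℕ n → Fin n → Fin n → ℚ
w s j k = if toℕ j ℕ.≤ᵇ toℕ k then (+ lookup s k) / 1 else 0ℚ

InPar : ∀ {n} → Vec ℕ n → Vec ℤ n → Set
InPar {n} s x =
  Σ (Fin n → ℚ) λ c →
    (∀ j → (0ℚ ℚ.≤ c j) × (c j ℚ.< 1ℚ)) ×
    (∀ k → lookup x k / 1 ≡ sumᶠ (λ j → c j ℚ.* w s j k))

-- x ∈ L^i(S): last coordinate equals i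
lastCoord : ∀ {m} → Vec ℤ (suc m) → ℤ
lastCoord {m} x = lookup x (Data.Fin.fromℕ m)

InΨ : ∀ {n} → Vec ℕ n → Vec ℕ n → Set
InΨ s r = ∀ k → lookup r k < lookup s k

REM : ∀ {n} (s : Vec ℕ n) → Positive s → Vec ℤ n → Vec ℕ n
REM s pos x = tabulate λ k → _%ℕ_ (lookup x k) (lookup s k) {{>-nonZero (pos k)}}

descents : List ℚ → ℕ
descents (a ∷ b ∷ rest) = (if does (b <? a) then 1 else 0) ℕ.+ descents (b ∷ rest)
descents _ = 0

des : ∀ {n} (s : Vec ℕ n) → Positive s → Vec ℕ n → ℕ
des s pos r = descents (toList (tabulate λ k →
  _/_ (+ lookup r k) (lookup s k) {{>-nonZero (pos k)}}))

HasCard : ∀ {A : Set} → (A → Set) → ℕ → Set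
HasCard {A} P N = Σ (List A) λ L → Unique L × (∀ a → (a ∈ L) ⇔ P a) × (length L ≡ N)

module Submission where

-- Write ρ_k = r_k / s_k for the remainders r = REM_s(x), and put ρ_0 = 0.  A vector x
-- lies in Par_s iff x_k = s_k (c_1 + ... + c_k) with every c_j ∈ [0,1); the partial
-- sums c_1 + ... + c_k are then D_k + ρ_k with D_k ∈ ℕ, and the constraints c_k ∈ [0,1)
-- force D_k = D_(k-1) + [ρ_k < ρ_(k-1)].  So x is recovered from its remainders by the
-- explicit map  lift : r ↦ (s_k D_k + r_k)_k,  D_k counting the descents of ρ_0,...,ρ_k;
-- conversely lift r lies in Par_s for every r ∈ Ψ_n.  When s_n = 1 we have ρ_n = 0, so
-- the last coordinate of x is D_n = des_s(REM_s(x)).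
--
-- Corollary 3.7 follows: the two set descriptions directly,
-- and the count because REM_s and lift restrict to mutually inverse bijections between
-- {x ∈ Par_s : last coordinate i} and {r ∈ Ψ_n : des_s(r) = i}, the latter being
-- enumerated by filtering an explicit list of Ψ_n.

open import Defs
open import Data.Nat as ℕ using (ℕ)
open import Data.Integer using (ℤ; +_)
open import Data.Vec using (Vec; last)
open import Data.Product using (Σ; _×_)
open import Function.Bundles using (_⇔_)
open import Relation.Binary.PropositionalEquality using (_≡_)

open import Data.Nat using (zero; suc; z≤n; s≤s; >-nonZero; _≟_)
import Data.Nat.Properties as ℕP
import Data.Nat.DivMod as ℕD
import Data.Integer as ℤ
import Data.Integer.Properties as ℤP
open import Data.Integer.DivMod using (_%ℕ_; _/ℕ_; a≡a%ℕn+[a/ℕn]*n; n%ℕd<d)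
open import Data.Rational as ℚ using (ℚ; 0ℚ; 1ℚ; _/_; toℚᵘ)
import Data.Rational.Properties as ℚP
import Data.Rational.Unnormalised as ℚᵘ
open import Data.Rational.Unnormalised using (ℚᵘ; mkℚᵘ)
import Data.Rational.Unnormalised.Properties as ℚᵘP
open import Data.Rational.Solver using (module +-*-Solver)
open import Data.Fin using (Fin; zero; suc; toℕ)
open import Data.Vec using ([]; _∷_; lookup; tabulate; toList)
import Data.Vec.Properties as VecP
open import Data.List using (List; []; _∷_; map; filter; upTo; cartesianProductWith; length)
open import Data.List.Properties using (length-map; map-∘; map-id-local)
open import Data.List.Membership.Propositional using (_∈_)
open import Data.List.Membership.Propositional.Properties
  using (∈-map⁺; ∈-map⁻; ∈-filter⁺; ∈-filter⁻; ∈-upTo⁺; ∈-upTo⁻; ∈-cartesianProductWith⁺; ∈-cartesianProductWith⁻)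
open import Data.List.Relation.Unary.Unique.Propositional using (Unique)
import Data.List.Relation.Unary.Unique.Propositional.Properties as UniqueP
open import Data.List.Relation.Unary.All as All using (All)
open import Data.List.Relation.Unary.Any using (here)
import Data.List.Relation.Unary.AllPairs as AllPairs
import Data.List.Relation.Unary.AllPairs.Properties as AllPairsP
open import Data.Unit using (⊤; tt)
open import Data.Sum using (_⊎_; inj₁; inj₂)
open import Data.Product using (_,_; proj₁; proj₂)
open import Data.Bool using (if_then_else_)
open import Function.Bundles using (mk⇔; Equivalence)
open import Data.Empty using (⊥-elim)
open import Relation.Nullary using (Dec; yes; no; does)
open import Relation.Nullary.Decidable using (dec-true; dec-false)
open import Relation.Binary.PropositionalEquality
  using (refl; sym; trans; cong; cong₂; subst; subst₂; module ≡-Reasoning)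

open +-*-Solver

ι : ℤ → ℚ
ι z = z / 1

-- Normalised rationals are compared through their unnormalised representatives;
-- these transfer lemmas pull such comparisons back along toℚᵘ.
toℚᵘ-ι : ∀ z → toℚᵘ (ι z) ℚᵘ.≃ mkℚᵘ z 0
toℚᵘ-ι z = ℚP.toℚᵘ-fromℚᵘ (mkℚᵘ z 0)

toℚᵘ-/ : ∀ z d → toℚᵘ (z / suc d) ℚᵘ.≃ mkℚᵘ z d
toℚᵘ-/ z d = ℚP.toℚᵘ-fromℚᵘ (mkℚᵘ z d)

≡-via-ℚᵘ : ∀ {p q} (p′ q′ : ℚᵘ) → toℚᵘ p ℚᵘ.≃ p′ → toℚᵘ q ℚᵘ.≃ q′ → p′ ℚᵘ.≃ q′ → p ≡ q
≡-via-ℚᵘ p′ q′ ep eq e = ℚP.toℚᵘ-injective (ℚᵘP.≃-trans ep (ℚᵘP.≃-trans e (ℚᵘP.≃-sym eq)))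

<-via-ℚᵘ : ∀ {p q} (p′ q′ : ℚᵘ) → toℚᵘ p ℚᵘ.≃ p′ → toℚᵘ q ℚᵘ.≃ q′ → p′ ℚᵘ.< q′ → p ℚ.< q
<-via-ℚᵘ p′ q′ ep eq lt =
  ℚP.toℚᵘ-cancel-< (ℚᵘP.<-respˡ-≃ (ℚᵘP.≃-sym ep) (ℚᵘP.<-respʳ-≃ (ℚᵘP.≃-sym eq) lt))

≤-via-ℚᵘ : ∀ {p q} (p′ q′ : ℚᵘ) → toℚᵘ p ℚᵘ.≃ p′ → toℚᵘ q ℚᵘ.≃ q′ → p′ ℚᵘ.≤ q′ → p ℚ.≤ q
≤-via-ℚᵘ p′ q′ ep eq le =
  ℚP.toℚᵘ-cancel-≤ (ℚᵘP.≤-respˡ-≃ (ℚᵘP.≃-sym ep) (ℚᵘP.≤-respʳ-≃ (ℚᵘP.≃-sym eq) le))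

ι-+ : ∀ a b → ι (a ℤ.+ b) ≡ ι a ℚ.+ ι b
ι-+ a b = ≡-via-ℚᵘ _ _ (toℚᵘ-ι (a ℤ.+ b))
  (ℚᵘP.≃-trans (ℚP.toℚᵘ-homo-+ (ι a) (ι b)) (ℚᵘP.+-cong (toℚᵘ-ι a) (toℚᵘ-ι b)))
  (ℚᵘ.*≡* (trans (ℤP.*-identityʳ (a ℤ.+ b))
    (sym (trans (ℤP.*-identityʳ _) (cong₂ ℤ._+_ (ℤP.*-identityʳ a) (ℤP.*-identityʳ b))))))

ι-* : ∀ a b → ι (a ℤ.* b) ≡ ι a ℚ.* ι b
ι-* a b = ≡-via-ℚᵘ _ _ (toℚᵘ-ι (a ℤ.* b))
  (ℚᵘP.≃-trans (ℚP.toℚᵘ-homo-* (ι a) (ι b)) (ℚᵘP.*-cong (toℚᵘ-ι a) (toℚᵘ-ι b)))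
  (ℚᵘ.*≡* refl)

ι-cancel-< : ∀ {a b} → ι a ℚ.< ι b → a ℤ.< b
ι-cancel-< {a} {b} lt with ℚᵘP.<-respˡ-≃ (toℚᵘ-ι a) (ℚᵘP.<-respʳ-≃ (toℚᵘ-ι b) (ℚP.toℚᵘ-mono-< lt))
... | ℚᵘ.*<* a*1<b*1 = subst₂ ℤ._<_ (ℤP.*-identityʳ a) (ℤP.*-identityʳ b) a*1<b*1

integer-between : ∀ t z → ι t ℚ.< ι z → ι z ℚ.< (ι t ℚ.+ 1ℚ) ℚ.+ 1ℚ → z ≡ ℤ.suc t
integer-between t z lo hi = ℤP.≤-antisym z≤t+1 (ℤP.i<j⇒suc[i]≤j (ι-cancel-< {t} {z} lo))
  where
  ι-t+2 : ι (ℤ.suc (ℤ.suc t)) ≡ (ι t ℚ.+ 1ℚ) ℚ.+ 1ℚ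
  ι-t+2 = trans (ι-+ (+ 1) (ℤ.suc t)) (trans (cong (1ℚ ℚ.+_) (ι-+ (+ 1) t))
            (solve 1 (λ x → con 1ℚ :+ (con 1ℚ :+ x) := (x :+ con 1ℚ) :+ con 1ℚ) refl (ι t)))
  z≤t+1 : z ℤ.≤ ℤ.suc t
  z≤t+1 = subst (z ℤ.≤_) (ℤP.pred-suc (ℤ.suc t))
            (ℤP.i<j⇒i≤pred[j] (ι-cancel-< {z} {ℤ.suc (ℤ.suc t)} (subst (ι z ℚ.<_) (sym ι-t+2) hi)))

ratio : (s r : ℕ) → 0 ℕ.< s → ℚ
ratio s r h = _/_ (+ r) s {{>-nonZero h}}

ratio-nonneg : ∀ s r h → 0ℚ ℚ.≤ ratio s r h
ratio-nonneg (suc s) r _ = ≤-via-ℚᵘ _ _ (toℚᵘ-ι (+ 0)) (toℚᵘ-/ (+ r) s)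
  (ℚᵘ.*≤* (subst₂ ℤ._≤_ (sym (ℤP.*-zeroˡ (+ suc s))) (sym (ℤP.*-identityʳ (+ r))) (ℤ.+≤+ z≤n)))

ratio-<1 : ∀ s r h → r ℕ.< s → ratio s r h ℚ.< 1ℚ
ratio-<1 (suc s) r _ r<s = <-via-ℚᵘ _ _ (toℚᵘ-/ (+ r) s) (toℚᵘ-ι (+ 1))
  (ℚᵘ.*<* (subst₂ ℤ._<_ (sym (ℤP.*-identityʳ (+ r))) (sym (ℤP.*-identityˡ _)) (ℤ.+<+ r<s)))

s*ratio : ∀ s r h → ι (+ s) ℚ.* ratio s r h ≡ ι (+ r)
s*ratio (suc s) r _ = ≡-via-ℚᵘ _ _
  (ℚᵘP.≃-trans (ℚP.toℚᵘ-homo-* (ι (+ suc s)) ((+ r) / suc s))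
               (ℚᵘP.*-cong (toℚᵘ-ι (+ suc s)) (toℚᵘ-/ (+ r) s)))
  (toℚᵘ-ι (+ r))
  (ℚᵘ.*≡* (trans (ℤP.*-identityʳ _) (trans (ℤP.*-comm (+ suc s) (+ r))
    (cong (λ k → + r ℤ.* + k) (sym (ℕP.*-identityˡ (suc s)))))))

*-cancel-pos : ∀ s → 0 ℕ.< s → ∀ X Y → ι (+ s) ℚ.* X ≡ ι (+ s) ℚ.* Y → X ≡ Y
*-cancel-pos (suc s) _ X Y eq = ℚP.≤-antisym
  (ℚP.*-cancelˡ-≤-pos (ι (+ suc s)) {{ℚP.normalize-pos (suc s) 1}} (ℚP.≤-reflexive eq))
  (ℚP.*-cancelˡ-≤-pos (ι (+ suc s)) {{ℚP.normalize-pos (suc s) 1}} (ℚP.≤-reflexive (sym eq)))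

ι-divMod : ∀ s (h : 0 ℕ.< s) (x : ℤ) →
  ι x ≡ ι (+ s) ℚ.* (ι (_/ℕ_ x s {{>-nonZero h}}) ℚ.+ ratio s (_%ℕ_ x s {{>-nonZero h}}) h)
ι-divMod s h x = begin
    ι x
  ≡⟨ cong ι (a≡a%ℕn+[a/ℕn]*n x s) ⟩
    ι (+ r ℤ.+ q ℤ.* + s)
  ≡⟨ trans (ι-+ (+ r) (q ℤ.* + s)) (cong (ι (+ r) ℚ.+_) (ι-* q (+ s))) ⟩
    ι (+ r) ℚ.+ ι q ℚ.* ι (+ s)
  ≡⟨ cong (ℚ._+ ι q ℚ.* ι (+ s)) (sym (s*ratio s r h)) ⟩
    ι (+ s) ℚ.* ratio s r h ℚ.+ ι q ℚ.* ι (+ s)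
  ≡⟨ solve 3 (λ S R Q → S :* R :+ Q :* S := S :* (Q :+ R)) refl (ι (+ s)) (ratio s r h) (ι q) ⟩
    ι (+ s) ℚ.* (ι q ℚ.+ ratio s r h) ∎
  where
  open ≡-Reasoning
  instance _ = >-nonZero h
  r = x %ℕ s
  q = x /ℕ s

-- Membership in Par_s through partial sums.  Coordinate k of Σ_j c_j w_j is
-- s_k (c_1 + ... + c_k); the prefix sums are named here.
prefix : ∀ {n} → (Fin n → ℚ) → Fin n → ℚ
prefix c zero    = c zero
prefix c (suc k) = c zero ℚ.+ prefix (λ j → c (suc j)) k

sumᶠ-cong : ∀ {n} {f g : Fin n → ℚ} → (∀ j → f j ≡ g j) → sumᶠ f ≡ sumᶠ g
sumᶠ-cong {zero}  eq = refl
sumᶠ-cong {suc n} eq = cong₂ ℚ._+_ (eq zero) (sumᶠ-cong (λ j → eq (suc j)))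

sumᶠ-zero : ∀ {n} {f : Fin n → ℚ} → (∀ j → f j ≡ 0ℚ) → sumᶠ f ≡ 0ℚ
sumᶠ-zero {zero}  eq = refl
sumᶠ-zero {suc n} eq = cong₂ ℚ._+_ (eq zero) (sumᶠ-zero (λ j → eq (suc j)))

w-suc : ∀ {n} a (s : Vec ℕ n) j k → w (a ∷ s) (suc j) (suc k) ≡ w s j k
w-suc a s j k with toℕ j
... | zero  = refl
... | suc _ = refl

coord-Σcw : ∀ {n} (s : Vec ℕ n) (c : Fin n → ℚ) k →
            sumᶠ (λ j → c j ℚ.* w s j k) ≡ ι (+ lookup s k) ℚ.* prefix c k
coord-Σcw (a ∷ s) c zero = begin
    c zero ℚ.* ι (+ a) ℚ.+ sumᶠ (λ j → c (suc j) ℚ.* 0ℚ)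
  ≡⟨ cong (c zero ℚ.* ι (+ a) ℚ.+_) (sumᶠ-zero (λ j → ℚP.*-zeroʳ (c (suc j)))) ⟩
    c zero ℚ.* ι (+ a) ℚ.+ 0ℚ
  ≡⟨ solve 2 (λ x y → x :* y :+ con 0ℚ := y :* x) refl (c zero) (ι (+ a)) ⟩
    ι (+ a) ℚ.* c zero ∎
  where open ≡-Reasoning
coord-Σcw (a ∷ s) c (suc k) = begin
    c zero ℚ.* sₖ ℚ.+ sumᶠ (λ j → c (suc j) ℚ.* w (a ∷ s) (suc j) (suc k))
  ≡⟨ cong (c zero ℚ.* sₖ ℚ.+_) (sumᶠ-cong (λ j → cong (c (suc j) ℚ.*_) (w-suc a s j k))) ⟩
    c zero ℚ.* sₖ ℚ.+ sumᶠ (λ j → c (suc j) ℚ.* w s j k)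
  ≡⟨ cong (c zero ℚ.* sₖ ℚ.+_) (coord-Σcw s (λ j → c (suc j)) k) ⟩
    c zero ℚ.* sₖ ℚ.+ sₖ ℚ.* prefix (λ j → c (suc j)) k
  ≡⟨ solve 3 (λ x y z → x :* y :+ y :* z := y :* (x :+ z)) refl (c zero) sₖ (prefix (λ j → c (suc j)) k) ⟩
    sₖ ℚ.* (c zero ℚ.+ prefix (λ j → c (suc j)) k) ∎
  where
  open ≡-Reasoning
  sₖ = ι (+ lookup s k)

Bounded : ∀ {n} → (Fin n → ℚ) → Set
Bounded {n} c = ∀ j → (0ℚ ℚ.≤ c j) × (c j ℚ.< 1ℚ)

-- ParFrom a s x: x_k = s_k (a + c_1 + ... + c_k) for some c_j ∈ [0,1), unfolded one
-- coordinate at a time (the current partial sum a is carried along).  Par_s is ParFrom 0.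
ParFrom : ∀ {n} → ℚ → Vec ℕ n → Vec ℤ n → Set
ParFrom a []       []       = ⊤
ParFrom a (s ∷ ss) (x ∷ xs) =
  Σ ℚ λ c → ((0ℚ ℚ.≤ c) × (c ℚ.< 1ℚ)) × (ι x ≡ ι (+ s) ℚ.* (a ℚ.+ c)) × ParFrom (a ℚ.+ c) ss xs

prefix⇒ParFrom : ∀ {n} a (s : Vec ℕ n) (x : Vec ℤ n) (c : Fin n → ℚ) → Bounded c →
                 (∀ k → ι (lookup x k) ≡ ι (+ lookup s k) ℚ.* (a ℚ.+ prefix c k)) → ParFrom a s x
prefix⇒ParFrom a []       []       c b e = tt
prefix⇒ParFrom a (s ∷ ss) (x ∷ xs) c b e = c zero , b zero , e zero ,
  prefix⇒ParFrom (a ℚ.+ c zero) ss xs (λ j → c (suc j)) (λ j → b (suc j))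
    (λ k → trans (e (suc k)) (cong (ι (+ lookup ss k) ℚ.*_) (sym (ℚP.+-assoc a (c zero) _))))

ParFrom⇒prefix : ∀ {n} a (s : Vec ℕ n) (x : Vec ℤ n) → ParFrom a s x →
                 Σ (Fin n → ℚ) λ c → Bounded c × (∀ k → ι (lookup x k) ≡ ι (+ lookup s k) ℚ.* (a ℚ.+ prefix c k))
ParFrom⇒prefix a []       []       tt = (λ ()) , (λ ()) , (λ ())
ParFrom⇒prefix a (s ∷ ss) (x ∷ xs) (c₀ , b₀ , e₀ , rest) with ParFrom⇒prefix (a ℚ.+ c₀) ss xs rest
... | c , b , e = c′ , b′ , e′
  where
  c′ : Fin (suc _) → ℚ
  c′ zero    = c₀
  c′ (suc j) = c j
  b′ : Bounded c′
  b′ zero    = b₀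
  b′ (suc j) = b j
  e′ : ∀ k → ι (lookup (x ∷ xs) k) ≡ ι (+ lookup (s ∷ ss) k) ℚ.* (a ℚ.+ prefix c′ k)
  e′ zero    = e₀
  e′ (suc k) = trans (e k) (cong (ι (+ lookup ss k) ℚ.*_) (ℚP.+-assoc a c₀ _))

InPar⇒ParFrom : ∀ {n} (s : Vec ℕ n) x → InPar s x → ParFrom 0ℚ s x
InPar⇒ParFrom s x (c , b , e) = prefix⇒ParFrom 0ℚ s x c b λ k → begin
    ι (lookup x k)                                ≡⟨ e k ⟩
    sumᶠ (λ j → c j ℚ.* w s j k)                  ≡⟨ coord-Σcw s c k ⟩
    ι (+ lookup s k) ℚ.* prefix c k               ≡⟨ cong (ι (+ lookup s k) ℚ.*_) (sym (ℚP.+-identityˡ _)) ⟩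
    ι (+ lookup s k) ℚ.* (0ℚ ℚ.+ prefix c k)      ∎
  where open ≡-Reasoning

ParFrom⇒InPar : ∀ {n} (s : Vec ℕ n) x → ParFrom 0ℚ s x → InPar s x
ParFrom⇒InPar s x par with ParFrom⇒prefix 0ℚ s x par
... | c , b , e = c , b , λ k → begin
    ι (lookup x k)                                ≡⟨ e k ⟩
    ι (+ lookup s k) ℚ.* (0ℚ ℚ.+ prefix c k)      ≡⟨ cong (ι (+ lookup s k) ℚ.*_) (ℚP.+-identityˡ _) ⟩
    ι (+ lookup s k) ℚ.* prefix c k               ≡⟨ sym (coord-Σcw s c k) ⟩
    sumᶠ (λ j → c j ℚ.* w s j k)                  ∎
  where open ≡-Reasoning

bit : ℚ → ℚ → ℕ
bit ρ p = if does (ρ ℚP.<? p) then 1 else 0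

bit-cases : ∀ ρ p → (ρ ℚ.< p × bit ρ p ≡ 1) ⊎ (p ℚ.≤ ρ × bit ρ p ≡ 0)
bit-cases ρ p with ρ ℚP.<? p
... | yes ρ<p = inj₁ (ρ<p , cong (λ b → if b then 1 else 0) (dec-true (ρ ℚP.<? p) ρ<p))
... | no  ρ≮p = inj₂ (ℚP.≮⇒≥ ρ≮p , cong (λ b → if b then 1 else 0) (dec-false (ρ ℚP.<? p) ρ≮p))

-- One step of the recursion: if the old partial sum is D + p and the new one is
-- D + p + c = Q + ρ with p, c, ρ ∈ [0,1) and Q an integer, then Q is confined to a
-- window around D whose halves are told apart by comparing ρ with p.
module Window (Q D p c ρ : ℚ) (E : Q ℚ.+ ρ ≡ (D ℚ.+ p) ℚ.+ c) where

  private
    Q≡ : Q ≡ ((D ℚ.+ p) ℚ.+ c) ℚ.+ ℚ.- ρ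
    Q≡ = trans (solve 2 (λ q r → q := (q :+ r) :+ (:- r)) refl Q ρ) (cong (ℚ._+ ℚ.- ρ) E)

    between : ∀ {L A B R} → L ≡ A → A ℚ.< B → B ≡ R → L ℚ.< R
    between refl lt refl = lt

  D<Q : ρ ℚ.< p → 0ℚ ℚ.≤ c → D ℚ.< Q
  D<Q ρ<p 0≤c = between (solve 2 (λ d r → d := ((d :+ r) :+ con 0ℚ) :+ (:- r)) refl D ρ)
    (ℚP.+-monoˡ-< (ℚ.- ρ) (ℚP.+-mono-<-≤ (ℚP.+-monoʳ-< D ρ<p) 0≤c)) (sym Q≡)

  Q<D+2 : p ℚ.< 1ℚ → c ℚ.< 1ℚ → 0ℚ ℚ.≤ ρ → Q ℚ.< (D ℚ.+ 1ℚ) ℚ.+ 1ℚ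
  Q<D+2 p<1 c<1 0≤ρ = between Q≡
    (ℚP.+-mono-<-≤ (ℚP.+-mono-< (ℚP.+-monoʳ-< D p<1) c<1) (ℚP.neg-antimono-≤ 0≤ρ))
    (solve 1 (λ d → ((d :+ con 1ℚ) :+ con 1ℚ) :+ con 0ℚ := (d :+ con 1ℚ) :+ con 1ℚ) refl D)

  Q<D+1 : p ℚ.≤ ρ → c ℚ.< 1ℚ → Q ℚ.< D ℚ.+ 1ℚ
  Q<D+1 p≤ρ c<1 = between
    (trans Q≡ (solve 4 (λ d p c r → ((d :+ p) :+ c) :+ (:- r) := (d :+ c) :+ (p :+ (:- r))) refl D p c ρ))
    (ℚP.+-mono-<-≤ (ℚP.+-monoʳ-< D c<1) (ℚP.+-monoˡ-≤ (ℚ.- ρ) p≤ρ))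
    (solve 2 (λ d r → (d :+ con 1ℚ) :+ (r :+ (:- r)) := d :+ con 1ℚ) refl D ρ)

  D-1<Q : 0ℚ ℚ.≤ p → 0ℚ ℚ.≤ c → ρ ℚ.< 1ℚ → D ℚ.+ ℚ.- 1ℚ ℚ.< Q
  D-1<Q 0≤p 0≤c ρ<1 = between
    (solve 1 (λ d → d :+ (:- con 1ℚ) := ((d :+ (:- con 1ℚ)) :+ con 0ℚ) :+ con 0ℚ) refl D)
    (ℚP.+-mono-<-≤ (ℚP.+-mono-<-≤ (ℚP.+-monoʳ-< D (ℚP.neg-antimono-< ρ<1)) 0≤p) 0≤c)
    (trans (solve 4 (λ d p c r → ((d :+ (:- r)) :+ p) :+ c := ((d :+ p) :+ c) :+ (:- r)) refl D p c ρ)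
           (sym Q≡))

-- Hence the integer part of the new partial sum is d + [ρ < p]: the descent count grows
-- exactly at descents.
integer-part-step : ∀ (q : ℤ) (d : ℕ) p c ρ → ι q ℚ.+ ρ ≡ (ι (+ d) ℚ.+ p) ℚ.+ c →
                    0ℚ ℚ.≤ p → p ℚ.< 1ℚ → 0ℚ ℚ.≤ c → c ℚ.< 1ℚ → 0ℚ ℚ.≤ ρ → ρ ℚ.< 1ℚ →
                    q ≡ + (d ℕ.+ bit ρ p)
integer-part-step q d p c ρ E 0≤p p<1 0≤c c<1 0≤ρ ρ<1 with bit-cases ρ p
... | inj₁ (ρ<p , b≡1) rewrite b≡1 =
  trans (integer-between (+ d) q (D<Q ρ<p 0≤c) (Q<D+2 p<1 c<1 0≤ρ)) (cong +_ (ℕP.+-comm 1 d))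
  where open Window (ι q) (ι (+ d)) p c ρ E
... | inj₂ (p≤ρ , b≡0) rewrite b≡0 =
  trans (integer-between (ℤ.pred (+ d)) q lo hi)
        (trans (ℤP.suc-pred (+ d)) (cong +_ (sym (ℕP.+-identityʳ d))))
  where
  open Window (ι q) (ι (+ d)) p c ρ E
  ι-d-1 : ι (ℤ.pred (+ d)) ≡ ι (+ d) ℚ.+ ℚ.- 1ℚ
  ι-d-1 = trans (ι-+ ℤ.-1ℤ (+ d)) (ℚP.+-comm _ (ι (+ d)))
  lo : ι (ℤ.pred (+ d)) ℚ.< ι q
  lo = subst (ℚ._< ι q) (sym ι-d-1) (D-1<Q 0≤p 0≤c ρ<1)
  hi : ι q ℚ.< (ι (ℤ.pred (+ d)) ℚ.+ 1ℚ) ℚ.+ 1ℚ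
  hi = subst (ι q ℚ.<_)
         (trans (solve 1 (λ D → D :+ con 1ℚ := ((D :+ (:- con 1ℚ)) :+ con 1ℚ) :+ con 1ℚ) refl (ι (+ d)))
                (cong (λ z → (z ℚ.+ 1ℚ) ℚ.+ 1ℚ) (sym ι-d-1)))
         (Q<D+1 p≤ρ c<1)

-- Conversely, stepping from partial sum d + p to (d + [ρ < p]) + ρ adds an increment
-- ([ρ < p] + ρ) - p that lies in [0,1).
increment-bounded : ∀ ρ p → 0ℚ ℚ.≤ p → p ℚ.< 1ℚ → 0ℚ ℚ.≤ ρ → ρ ℚ.< 1ℚ →
                    (0ℚ ℚ.≤ (ι (+ bit ρ p) ℚ.+ ρ) ℚ.+ ℚ.- p) × ((ι (+ bit ρ p) ℚ.+ ρ) ℚ.+ ℚ.- p ℚ.< 1ℚ)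
increment-bounded ρ p 0≤p p<1 0≤ρ ρ<1 with bit-cases ρ p
... | inj₁ (ρ<p , b≡1) rewrite b≡1 =
  subst (ℚ._≤ (1ℚ ℚ.+ ρ) ℚ.+ ℚ.- p) (solve 1 (λ p → (p :+ con 0ℚ) :+ (:- p) := con 0ℚ) refl p)
        (ℚP.+-monoˡ-≤ (ℚ.- p) (ℚP.+-mono-≤ (ℚP.<⇒≤ p<1) 0≤ρ)) ,
  subst ((1ℚ ℚ.+ ρ) ℚ.+ ℚ.- p ℚ.<_) (solve 1 (λ p → (con 1ℚ :+ p) :+ (:- p) := con 1ℚ) refl p)
        (ℚP.+-monoˡ-< (ℚ.- p) (ℚP.+-monoʳ-< 1ℚ ρ<p))
... | inj₂ (p≤ρ , b≡0) rewrite b≡0 =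
  subst₂ ℚ._≤_ (solve 1 (λ p → p :+ (:- p) := con 0ℚ) refl p)
               (solve 2 (λ r p → r :+ (:- p) := (con 0ℚ :+ r) :+ (:- p)) refl ρ p)
        (ℚP.+-monoˡ-≤ (ℚ.- p) p≤ρ) ,
  subst₂ ℚ._<_ (solve 2 (λ r p → r :+ (:- p) := (con 0ℚ :+ r) :+ (:- p)) refl ρ p)
               (solve 0 (con 1ℚ :+ con 0ℚ := con 1ℚ) refl)
        (ℚP.+-mono-<-≤ ρ<1 (ℚP.neg-antimono-≤ 0≤p))

pos-tail : ∀ {n a} {s : Vec ℕ n} → Positive (a ∷ s) → Positive s
pos-tail pos k = pos (suc k)

-- The inverse of REM_s.  lift p d s r builds the coordinates s_k D_k + r_k, where the
-- previous ratio is p and the descent count so far is d; D_k = d + [ρ_k < p].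
lift : ∀ {n} → ℚ → ℕ → (s : Vec ℕ n) → Positive s → Vec ℕ n → Vec ℤ n
lift p d []       pos []       = []
lift p d (s ∷ ss) pos (r ∷ rs) =
  let ρ = ratio s r (pos zero); d′ = d ℕ.+ bit ρ p
  in + (s ℕ.* d′ ℕ.+ r) ∷ lift ρ d′ ss (pos-tail pos) rs

lift-REM : ∀ {n} (s : Vec ℕ n) (pos : Positive s) (x : Vec ℤ n) p d → 0ℚ ℚ.≤ p → p ℚ.< 1ℚ →
           ParFrom (ι (+ d) ℚ.+ p) s x → x ≡ lift p d s pos (REM s pos x)
lift-REM []       pos []       p d _ _ _ = refl
lift-REM (s ∷ ss) pos (x ∷ xs) p d 0≤p p<1 (c , (0≤c , c<1) , x≡ , rest) =
  cong₂ _∷_ head≡ (lift-REM ss (pos-tail pos) xs ρ d′ (ratio-nonneg s r h) ρ<1 rest′)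
  where
  h = pos zero
  instance _ = >-nonZero h
  r = x %ℕ s
  q = x /ℕ s
  ρ = ratio s r h
  d′ = d ℕ.+ bit ρ p
  ρ<1 : ρ ℚ.< 1ℚ
  ρ<1 = ratio-<1 s r h (n%ℕd<d x s)
  E : ι q ℚ.+ ρ ≡ (ι (+ d) ℚ.+ p) ℚ.+ c
  E = *-cancel-pos s h _ _ (trans (sym (ι-divMod s h x)) x≡)
  q≡d′ : q ≡ + d′
  q≡d′ = integer-part-step q d p c ρ E 0≤p p<1 0≤c c<1 (ratio-nonneg s r h) ρ<1
  head≡ : x ≡ + (s ℕ.* d′ ℕ.+ r)
  head≡ = begin
      x                              ≡⟨ a≡a%ℕn+[a/ℕn]*n x s ⟩
      + r ℤ.+ q ℤ.* + s              ≡⟨ cong (λ z → + r ℤ.+ z ℤ.* + s) q≡d′ ⟩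
      + r ℤ.+ + d′ ℤ.* + s           ≡⟨ cong (ℤ._+_ (+ r)) (sym (ℤP.pos-* d′ s)) ⟩
      + r ℤ.+ + (d′ ℕ.* s)           ≡⟨ sym (ℤP.pos-+ r (d′ ℕ.* s)) ⟩
      + (r ℕ.+ d′ ℕ.* s)             ≡⟨ cong +_ (rearrange r d′ s) ⟩
      + (s ℕ.* d′ ℕ.+ r)             ∎
    where
    open ≡-Reasoning
    rearrange : ∀ a b c → a ℕ.+ b ℕ.* c ≡ c ℕ.* b ℕ.+ a
    rearrange a b c = trans (ℕP.+-comm a (b ℕ.* c)) (cong (ℕ._+ a) (ℕP.*-comm b c))
  rest′ : ParFrom (ι (+ d′) ℚ.+ ρ) ss xs
  rest′ = subst (λ a → ParFrom a ss xs) (trans (sym E) (cong (λ z → ι z ℚ.+ ρ) q≡d′)) rest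

lift-ParFrom : ∀ {n} (s : Vec ℕ n) (pos : Positive s) (r : Vec ℕ n) p d → 0ℚ ℚ.≤ p → p ℚ.< 1ℚ →
               InΨ s r → ParFrom (ι (+ d) ℚ.+ p) s (lift p d s pos r)
lift-ParFrom []       pos []       p d _ _ _ = tt
lift-ParFrom (s ∷ ss) pos (r ∷ rs) p d 0≤p p<1 ψ =
  c , bounds , coord≡ ,
  subst (λ a → ParFrom a ss (lift ρ d′ ss (pos-tail pos) rs)) (sym old+c)
        (lift-ParFrom ss (pos-tail pos) rs ρ d′ (ratio-nonneg s r h) ρ<1 (λ k → ψ (suc k)))
  where
  h = pos zero
  ρ = ratio s r h
  b = bit ρ p
  d′ = d ℕ.+ b
  ρ<1 = ratio-<1 s r h (ψ zero)
  c = (ι (+ d′) ℚ.+ ρ) ℚ.+ ℚ.- (ι (+ d) ℚ.+ p)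
  old+c : (ι (+ d) ℚ.+ p) ℚ.+ c ≡ ι (+ d′) ℚ.+ ρ
  old+c = solve 2 (λ A B → A :+ (B :+ (:- A)) := B) refl (ι (+ d) ℚ.+ p) (ι (+ d′) ℚ.+ ρ)
  c≡ : c ≡ (ι (+ b) ℚ.+ ρ) ℚ.+ ℚ.- p
  c≡ = trans (cong (λ z → (z ℚ.+ ρ) ℚ.+ ℚ.- (ι (+ d) ℚ.+ p)) (trans (cong ι (ℤP.pos-+ d b)) (ι-+ (+ d) (+ b))))
    (solve 4 (λ D B R P → ((D :+ B) :+ R) :+ (:- (D :+ P)) := (B :+ R) :+ (:- P)) refl (ι (+ d)) (ι (+ b)) ρ p)
  bounds : (0ℚ ℚ.≤ c) × (c ℚ.< 1ℚ)
  bounds = subst (0ℚ ℚ.≤_) (sym c≡) (proj₁ increment) , subst (ℚ._< 1ℚ) (sym c≡) (proj₂ increment)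
    where increment = increment-bounded ρ p 0≤p p<1 (ratio-nonneg s r h) ρ<1
  coord≡ : ι (+ (s ℕ.* d′ ℕ.+ r)) ≡ ι (+ s) ℚ.* ((ι (+ d) ℚ.+ p) ℚ.+ c)
  coord≡ = begin
      ι (+ (s ℕ.* d′ ℕ.+ r))                       ≡⟨ cong ι (ℤP.pos-+ (s ℕ.* d′) r) ⟩
      ι (+ (s ℕ.* d′) ℤ.+ + r)                     ≡⟨ ι-+ (+ (s ℕ.* d′)) (+ r) ⟩
      ι (+ (s ℕ.* d′)) ℚ.+ ι (+ r)                 ≡⟨ cong (ℚ._+ ι (+ r)) (cong ι (ℤP.pos-* s d′)) ⟩
      ι (+ s ℤ.* + d′) ℚ.+ ι (+ r)                 ≡⟨ cong₂ ℚ._+_ (ι-* (+ s) (+ d′)) (sym (s*ratio s r h)) ⟩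
      ι (+ s) ℚ.* ι (+ d′) ℚ.+ ι (+ s) ℚ.* ρ       ≡⟨ sym (ℚP.*-distribˡ-+ (ι (+ s)) (ι (+ d′)) ρ) ⟩
      ι (+ s) ℚ.* (ι (+ d′) ℚ.+ ρ)                 ≡⟨ cong (ι (+ s) ℚ.*_) (sym old+c) ⟩
      ι (+ s) ℚ.* ((ι (+ d) ℚ.+ p) ℚ.+ c)          ∎
    where open ≡-Reasoning

-- The remainders of lift r are r itself (s_k D_k + r_k ≡ r_k mod s_k, as r_k < s_k).
REM-lift : ∀ {n} (s : Vec ℕ n) (pos : Positive s) (r : Vec ℕ n) p d → InΨ s r →
           REM s pos (lift p d s pos r) ≡ r
REM-lift []       pos []       p d ψ = refl
REM-lift (s ∷ ss) pos (r ∷ rs) p d ψ =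
  cong₂ _∷_ head≡ (REM-lift ss (pos-tail pos) rs _ _ (λ k → ψ (suc k)))
  where
  instance _ = >-nonZero (pos zero)
  d′ = d ℕ.+ bit (ratio s r (pos zero)) p
  head≡ : (s ℕ.* d′ ℕ.+ r) ℕ.% s ≡ r
  head≡ = trans (cong (ℕ._% s) (trans (ℕP.+-comm (s ℕ.* d′) r) (cong (r ℕ.+_) (ℕP.*-comm s d′))))
                (trans (ℕD.[m+kn]%n≡m%n r d′ s) (ℕD.m<n⇒m%n≡m (ψ zero)))

ratios : ∀ {n} (s : Vec ℕ n) → Positive s → Vec ℕ n → List ℚ
ratios s pos r = toList (tabulate λ k → ratio (lookup s k) (lookup r k) (pos k))

-- When s_n = 1 (so r_n = 0), the last coordinate of lift is the final descent count.
last-lift : ∀ {m} (s : Vec ℕ (suc m)) (pos : Positive s) r p d → last s ≡ 1 → InΨ s r →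
            lastCoord (lift p d s pos r) ≡ + (d ℕ.+ descents (p ∷ ratios s pos r))
last-lift {zero} (s ∷ []) pos (zero ∷ []) p d refl ψ =
  cong +_ (trans (ℕP.+-identityʳ _) (trans (ℕP.*-identityˡ _) (cong (d ℕ.+_) (sym (ℕP.+-identityʳ _)))))
last-lift {zero} (s ∷ []) pos (suc r ∷ []) p d refl ψ with ψ zero
... | s≤s ()
last-lift {suc m} (s ∷ s₁ ∷ ss) pos (r ∷ rs) p d e ψ =
  trans (last-lift (s₁ ∷ ss) (pos-tail pos) rs _ _ e (λ k → ψ (suc k))) (cong +_ (ℕP.+-assoc d _ _))

REM⁻¹ : ∀ {n} (s : Vec ℕ n) → Positive s → Vec ℕ n → Vec ℤ n
REM⁻¹ s pos = lift 0ℚ 0 s pos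

0<1 : 0ℚ ℚ.< 1ℚ
0<1 = ℚ.*<* (ℤ.+<+ (s≤s z≤n))

REM⁻¹-REM : ∀ {n} (s : Vec ℕ n) pos x → InPar s x → REM⁻¹ s pos (REM s pos x) ≡ x
REM⁻¹-REM s pos x x∈Par = sym (lift-REM s pos x 0ℚ 0 ℚP.≤-refl 0<1
  (subst (λ a → ParFrom a s x) (sym (ℚP.+-identityʳ 0ℚ)) (InPar⇒ParFrom s x x∈Par)))

REM-REM⁻¹ : ∀ {n} (s : Vec ℕ n) pos r → InΨ s r → REM s pos (REM⁻¹ s pos r) ≡ r
REM-REM⁻¹ s pos r = REM-lift s pos r 0ℚ 0

REM⁻¹-InPar : ∀ {n} (s : Vec ℕ n) pos r → InΨ s r → InPar s (REM⁻¹ s pos r)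
REM⁻¹-InPar s pos r ψ = ParFrom⇒InPar s _
  (subst (λ a → ParFrom a s (REM⁻¹ s pos r)) (ℚP.+-identityʳ 0ℚ) (lift-ParFrom s pos r 0ℚ 0 ℚP.≤-refl 0<1 ψ))

REM-InΨ : ∀ {n} (s : Vec ℕ n) pos x → InΨ s (REM s pos x)
REM-InΨ s pos x k = subst (ℕ._< lookup s k) (sym (VecP.lookup∘tabulate _ k))
  (n%ℕd<d (lookup x k) (lookup s k) {{>-nonZero (pos k)}})

-- The first ratio is ≥ 0, so the leading pair (0, ρ_1) is never a descent.
lastCoord-REM⁻¹ : ∀ m (s : Vec ℕ (suc m)) pos r → last s ≡ 1 → InΨ s r →
                  lastCoord (REM⁻¹ s pos r) ≡ + des s pos r
lastCoord-REM⁻¹ m (s ∷ ss) pos (r ∷ rs) e ψ with bit-cases (ratio s r (pos zero)) 0ℚ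
... | inj₁ (ρ<0 , _) = ⊥-elim (ℚP.<-irrefl refl (ℚP.≤-<-trans (ratio-nonneg s r (pos zero)) ρ<0))
... | inj₂ (_ , b≡0) = trans (last-lift (s ∷ ss) pos (r ∷ rs) 0ℚ 0 e ψ)
                              (cong (λ b → + (b ℕ.+ des (s ∷ ss) pos (r ∷ rs))) b≡0)

lastCoord-InPar : ∀ m (s : Vec ℕ (suc m)) pos x → last s ≡ 1 → InPar s x →
                  lastCoord x ≡ + des s pos (REM s pos x)
lastCoord-InPar m s pos x e x∈Par = begin
    lastCoord x                              ≡⟨ cong lastCoord (sym (REM⁻¹-REM s pos x x∈Par)) ⟩
    lastCoord (REM⁻¹ s pos (REM s pos x))     ≡⟨ lastCoord-REM⁻¹ m s pos (REM s pos x) e (REM-InΨ s pos x) ⟩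
    + des s pos (REM s pos x)                ∎
  where open ≡-Reasoning

lastCoord≡⇔des≡ : ∀ m (s : Vec ℕ (suc m)) pos → last s ≡ 1 → ∀ i x → InPar s x →
                  (lastCoord x ≡ + i) ⇔ (des s pos (REM s pos x) ≡ i)
lastCoord≡⇔des≡ m s pos e i x x∈Par =
  mk⇔ (λ l → ℤP.+-injective (trans (sym (lastCoord-InPar m s pos x e x∈Par)) l))
      (λ d → trans (lastCoord-InPar m s pos x e x∈Par) (cong +_ d))

elemsΨ : ∀ {n} → Vec ℕ n → List (Vec ℕ n)
elemsΨ []       = [] ∷ []
elemsΨ (s ∷ ss) = cartesianProductWith _∷_ (upTo s) (elemsΨ ss)

elemsΨ-unique : ∀ {n} (s : Vec ℕ n) → Unique (elemsΨ s)
elemsΨ-unique []       = All.[] AllPairs.∷ AllPairs.[]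
elemsΨ-unique (s ∷ ss) =
  UniqueP.cartesianProductWith⁺ _∷_ VecP.∷-injective (UniqueP.upTo⁺ s) (elemsΨ-unique ss)

∈-elemsΨ⁻ : ∀ {n} (s : Vec ℕ n) r → r ∈ elemsΨ s → InΨ s r
∈-elemsΨ⁻ []       []  (here refl) ()
∈-elemsΨ⁻ (s ∷ ss) r r∈ with ∈-cartesianProductWith⁻ _∷_ (upTo s) (elemsΨ ss) r∈
... | a , v , a∈ , v∈ , refl = λ { zero → ∈-upTo⁻ a∈ ; (suc k) → ∈-elemsΨ⁻ ss v v∈ k }

∈-elemsΨ⁺ : ∀ {n} (s : Vec ℕ n) r → InΨ s r → r ∈ elemsΨ s
∈-elemsΨ⁺ []       []       ψ = here refl
∈-elemsΨ⁺ (s ∷ ss) (r ∷ rs) ψ =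
  ∈-cartesianProductWith⁺ _∷_ (∈-upTo⁺ (ψ zero)) (∈-elemsΨ⁺ ss rs (λ k → ψ (suc k)))

countΨ : ∀ {n} (s : Vec ℕ n) {P : Vec ℕ n → Set} → (∀ r → Dec (P r)) → ℕ
countΨ s P? = length (filter P? (elemsΨ s))

HasCard-Ψ : ∀ {n} (s : Vec ℕ n) {P : Vec ℕ n → Set} (P? : ∀ r → Dec (P r)) →
            HasCard (λ r → InΨ s r × P r) (countΨ s P?)
HasCard-Ψ s P? = filter P? (elemsΨ s) , UniqueP.filter⁺ P? (elemsΨ-unique s) , members , refl
  where
  members : ∀ r → (r ∈ filter P? (elemsΨ s)) ⇔ (InΨ s r × _)
  members r = mk⇔ (λ r∈ → let (r∈Ψ , pr) = ∈-filter⁻ P? {xs = elemsΨ s} r∈ in ∈-elemsΨ⁻ s r r∈Ψ , pr)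
                  (λ (ψ , pr) → ∈-filter⁺ P? (∈-elemsΨ⁺ s r ψ) pr)

unique-map-retract : ∀ {A B : Set} (g : B → A) (h : A → B) {L : List A} →
                     All (λ a → g (h a) ≡ a) L → Unique L → Unique (map h L)
unique-map-retract g h {L} g∘h≡id uniq =
  AllPairs.map (λ ne eq → ne (cong g eq)) (AllPairsP.map⁻ (subst Unique (sym map-g∘h≡L) uniq))
  where
  map-g∘h≡L : map g (map h L) ≡ L
  map-g∘h≡L = trans (sym (map-∘ L)) (map-id-local g∘h≡id)

HasCard-bijection : ∀ {A B : Set} {Q : A → Set} {P : B → Set} (g : B → A) (h : A → B) {N : ℕ} →
                    (∀ a → Q a → g (h a) ≡ a × P (h a)) → (∀ b → P b → Q (g b) × h (g b) ≡ b) →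
                    HasCard Q N → HasCard P N
HasCard-bijection {P = P} g h h-into g-into (L , uniq , ∈L , refl) =
  map h L , unique-map-retract g h (All.tabulate (λ a∈ → proj₁ (h-into _ (to (∈L _) a∈)))) uniq ,
  members , length-map h L
  where
  open Equivalence
  members : ∀ b → (b ∈ map h L) ⇔ P b
  members b = mk⇔ into onto
    where
    into : b ∈ map h L → P b
    into b∈ with ∈-map⁻ h b∈
    ... | a , a∈ , refl = proj₂ (h-into a (to (∈L a) a∈))
    onto : P b → b ∈ map h L
    onto pb = let (q , hg≡b) = g-into b pb in subst (_∈ map h L) hg≡b (∈-map⁺ h (from (∈L (g b)) q))

corollary3p7 : (m : ℕ) (s : Vec ℕ (ℕ.suc m)) (pos : Positive s) → last s ≡ 1 → (i : ℕ) →
    ((x : Vec ℤ (ℕ.suc m)) → (InPar s x × lastCoord x ≡ + i) ⇔ (InPar s x × des s pos (REM s pos x) ≡ i))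
    × ((x : Vec ℤ (ℕ.suc m)) → (InPar s x × lastCoord x ≡ + i) ⇔ Σ (Vec ℕ (ℕ.suc m)) (λ r → InΨ s r × des s pos r ≡ i × InPar s x × REM s pos x ≡ r))
    × Σ ℕ (λ N → HasCard (λ x → InPar s x × lastCoord x ≡ + i) N × HasCard (λ r → InΨ s r × des s pos r ≡ i) N)
corollary3p7 m s pos e i =
  byRemainders , byPreimage , countΨ s des≡i? ,
  HasCard-bijection (REM s pos) (REM⁻¹ s pos) REM⁻¹-into REM-into (HasCard-Ψ s des≡i?) ,
  HasCard-Ψ s des≡i?
  where
  open Equivalence
  des≡i? : (r : Vec ℕ (suc m)) → Dec (des s pos r ≡ i)
  des≡i? r = des s pos r ≟ i
  last⇔des : ∀ x → InPar s x → (lastCoord x ≡ + i) ⇔ (des s pos (REM s pos x) ≡ i)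
  last⇔des = lastCoord≡⇔des≡ m s pos e i

  byRemainders : ∀ x → (InPar s x × lastCoord x ≡ + i) ⇔ (InPar s x × des s pos (REM s pos x) ≡ i)
  byRemainders x = mk⇔ (λ (x∈Par , l) → x∈Par , to (last⇔des x x∈Par) l)
                       (λ (x∈Par , d) → x∈Par , from (last⇔des x x∈Par) d)

  byPreimage : ∀ x → (InPar s x × lastCoord x ≡ + i) ⇔
                Σ (Vec ℕ (suc m)) (λ r → InΨ s r × des s pos r ≡ i × InPar s x × REM s pos x ≡ r)
  byPreimage x =
    mk⇔ (λ (x∈Par , l) → REM s pos x , REM-InΨ s pos x , to (last⇔des x x∈Par) l , x∈Par , refl)
        (λ (r , _ , d , x∈Par , REM≡r) → x∈Par , from (last⇔des x x∈Par) (trans (cong (des s pos) REM≡r) d))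

  REM⁻¹-into : ∀ r → InΨ s r × des s pos r ≡ i →
               REM s pos (REM⁻¹ s pos r) ≡ r × (InPar s (REM⁻¹ s pos r) × lastCoord (REM⁻¹ s pos r) ≡ + i)
  REM⁻¹-into r (ψ , d) =
    REM-REM⁻¹ s pos r ψ , REM⁻¹-InPar s pos r ψ , trans (lastCoord-REM⁻¹ m s pos r e ψ) (cong +_ d)

  REM-into : ∀ x → InPar s x × lastCoord x ≡ + i →
             (InΨ s (REM s pos x) × des s pos (REM s pos x) ≡ i) × REM⁻¹ s pos (REM s pos x) ≡ x
  REM-into x (x∈Par , l) = (REM-InΨ s pos x , to (last⇔des x x∈Par) l) , REM⁻¹-REM s pos x x∈Par
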